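{- Let $G$ be a cubic graph with $|V(G)|\ge 4$ and let $v\in V(G)$. If $G^v$ is a Klee-graph, then $G$ is a Klee-graph.
   Context: For a cubic graph $G$ and $v\in V(G)$ with neighbours $x_1,x_2,x_3$, $G^v$ is the cubic graph obtained by replacing $v$ with a triangle: delete $v$, add new vertices $v_1,v_2,v_3$, the edges $v_1x_1,v_2x_2,v_3x_3$ and the edges $v_1v_2,v_2v_3,v_3v_1$. The class of Klee-graphs is defined recursively: $K_4$ is a Klee-graph, and if $H$ is a Klee-graph and $w\in V(H)$ then $H^w$ is a Klee-graph; there are no other Klee-graphs. -}

module Defs where

open import Data.Fin using (Fin; zero; suc)
open import Data.Nat using (ℕ)
open import Data.Product using (Σ; _×_; _,_; proj₁; proj₂)
open import Data.Sum using (_⊎_; inj₁; inj₂)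
open import Relation.Nullary using (yes; no; ¬_)
open import Relation.Binary.Definitions using (DecidableEquality)
open import Relation.Binary.PropositionalEquality using (_≡_)
open import Function.Bundles using (_↔_; Inverse)

-- A cubic (loopless multi)graph is encoded by half-edges ("darts"):
-- every vertex u carries exactly three darts (u , 0), (u , 1), (u , 2),
-- and the edges are the orbits of size 2 of an involution σ on darts.
record Graph : Set₁ where
  field
    V   : Set
    _≟_ : DecidableEquality V
    σ   : V × Fin 3 → V × Fin 3

open Graph public

Dart : Graph → Set
Dart G = V G × Fin 3

-- the graph axioms: σ is an involution without loops
-- (looplessness also makes σ fixed-point free)
record IsCubic (G : Graph) : Set where
  field
    invol    : ∀ d → σ G (σ G d) ≡ d
    loopless : ∀ d → ¬ (proj₁ (σ G d) ≡ proj₁ d)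

HasOrder : Graph → ℕ → Set
HasOrder G n = V G ↔ Fin n

record _≅_ (G H : Graph) : Set where
  field
    vmap : V G ↔ V H
    dmap : Dart G ↔ Dart H
    incidence : ∀ d → proj₁ (Inverse.to dmap d) ≡ Inverse.to vmap (proj₁ d)
    edges     : ∀ d → Inverse.to dmap (σ G d) ≡ σ H (Inverse.to dmap d)

-- K4: vertex a has neighbours (in order) the other three vertices
K4σ : Fin 4 × Fin 3 → Fin 4 × Fin 3
K4σ (zero , j) = suc j , zero
K4σ (suc zero , zero) = zero , zero
K4σ (suc zero , suc zero) = suc (suc zero) , suc zero
K4σ (suc zero , suc (suc zero)) = suc (suc (suc zero)) , suc zero
K4σ (suc (suc zero) , zero) = zero , suc zero
K4σ (suc (suc zero) , suc zero) = suc zero , suc zero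
K4σ (suc (suc zero) , suc (suc zero)) = suc (suc (suc zero)) , suc (suc zero)
K4σ (suc (suc (suc zero)) , zero) = zero , suc (suc zero)
K4σ (suc (suc (suc zero)) , suc zero) = suc zero , suc (suc zero)
K4σ (suc (suc (suc zero)) , suc (suc zero)) = suc (suc zero) , suc (suc zero)

K4 : Graph
K4 = record { V = Fin 4 ; _≟_ = Data.Fin._≟_ ; σ = K4σ }

next prev : Fin 3 → Fin 3
next zero = suc zero
next (suc zero) = suc (suc zero)
next (suc (suc zero)) = zero
prev zero = suc (suc zero)
prev (suc zero) = zero
prev (suc (suc zero)) = suc zero

-- G ^ v : replace v by a triangle v₁ v₂ v₃.
-- Vertex set V ⊎ Fin 2: the old vertices, where v itself plays v₁,
-- and inj₂ 0, inj₂ 1 play v₂, v₃.  The neighbour x_i of v along dart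
-- (v , i) becomes attached to v_{i+1} via its dart 0; darts 1 and 2 of
-- the v_i form the triangle.
module Expand (G : Graph) (v : V G) where
  V' : Set
  V' = V G ⊎ Fin 2

  t : Fin 3 → V'
  t zero = inj₁ v
  t (suc i) = inj₂ i

  ext : V G × Fin 3 → V' × Fin 3
  ext (w , k) with _≟_ G w v
  ... | yes _ = t k , zero
  ... | no  _ = inj₁ w , k

  tri : Fin 3 → Fin 3 → V' × Fin 3
  tri i zero = inj₁ (proj₁ (σ G (v , i))) , proj₂ (σ G (v , i))
  tri i (suc zero) = t (next i) , suc (suc zero)
  tri i (suc (suc zero)) = t (prev i) , suc zero

  σ' : V' × Fin 3 → V' × Fin 3
  σ' (inj₁ u , j) with _≟_ G u v
  ... | yes _ = tri zero j
  ... | no  _ = ext (σ G (u , j))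
  σ' (inj₂ i , j) = tri (suc i) j

  _≟'_ : DecidableEquality V'
  inj₁ a ≟' inj₁ b with _≟_ G a b
  ... | yes Relation.Binary.PropositionalEquality.refl = yes Relation.Binary.PropositionalEquality.refl
  ... | no p = no λ { Relation.Binary.PropositionalEquality.refl → p Relation.Binary.PropositionalEquality.refl }
  inj₁ a ≟' inj₂ b = no λ ()
  inj₂ a ≟' inj₁ b = no λ ()
  inj₂ a ≟' inj₂ b with a Data.Fin.≟ b
  ... | yes Relation.Binary.PropositionalEquality.refl = yes Relation.Binary.PropositionalEquality.refl
  ... | no p = no λ { Relation.Binary.PropositionalEquality.refl → p Relation.Binary.PropositionalEquality.refl }

  graph : Graph
  graph = record { V = V' ; _≟_ = _≟'_ ; σ = σ' }

_^_ : (G : Graph) → V G → Graph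
G ^ v = Expand.graph G v

data Klee : Graph → Set₁ where
  k4   : ∀ {G} → G ≅ K4 → Klee G
  step : ∀ {G} (H : Graph) (w : V H) → Klee H → G ≅ (H ^ w) → Klee G

{-# OPTIONS --safe #-}
-- Contracting a triangle S of a cubic graph B to a single vertex gives a graph B / S,
-- and contracting the triangle of G ^ v gives back G.  So it suffices to show that
-- contracting any triangle of a Klee-graph X yields a Klee-graph or a two-vertex graph,
-- the latter being excluded for G by |V G| ≥ 4.  This goes by induction on X.  A triangle
-- of K4 contracts to two vertices.  If X ≅ H ^ w, then, H being simple, a triangle of
-- H ^ w is either the new triangle, whose contraction is H, or disjoint from it; in the
-- second case it comes from a triangle T of H avoiding w and the contraction is
-- (H / T) ^ w, which is Klee since H / T is Klee by induction or has two vertices, in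
-- which case (H / T) ^ w ≅ K4.

module Submission where

open import Defs
open import Data.Nat as ℕ using (ℕ; _≤_; s≤s)
open import Data.Nat.Properties using (n<1+n; n≤1+n; ≤-trans)
open import Data.Fin using (Fin; zero; suc; punchOut)
import Data.Fin.Properties as Fin
open import Data.Product using (Σ; _×_; _,_; proj₁; proj₂; ∃)
open import Data.Product.Properties using (,-injectiveʳ; ≡-dec)
import Data.Sum as Sum
open import Data.Sum using (_⊎_; inj₁; inj₂)
open import Data.Sum.Properties using (inj₁-injective; inj₂-injective)
open import Data.Bool using (Bool; not; _∧_; T)
open import Data.Bool.Properties using (T-irrelevant)
open import Data.Unit using (tt)
open import Data.Empty using (⊥; ⊥-elim)
open import Relation.Nullary using (Dec; yes; no; ¬_)
open import Relation.Nullary.Decidable using (⌊_⌋; toWitness; ¬?; _→-dec_)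
open import Relation.Binary.PropositionalEquality
open import Function.Base using (_∘_)
open import Function.Bundles using (Inverse; mk↔ₛ′)
open import Function.Definitions using (Injective)

next-prev : ∀ i → next (prev i) ≡ i
next-prev zero = refl
next-prev (suc zero) = refl
next-prev (suc (suc zero)) = refl

prev-next : ∀ i → prev (next i) ≡ i
prev-next zero = refl
prev-next (suc zero) = refl
prev-next (suc (suc zero)) = refl

next≢id : ∀ i → next i ≢ i
next≢id zero ()
next≢id (suc zero) ()
next≢id (suc (suc zero)) ()

prev≢id : ∀ i → prev i ≢ i
prev≢id zero ()
prev≢id (suc zero) ()
prev≢id (suc (suc zero)) ()

next≢prev : ∀ i → next i ≢ prev i
next≢prev zero ()
next≢prev (suc zero) ()
next≢prev (suc (suc zero)) ()

≢⇒next⊎prev : ∀ i j → j ≢ i → j ≡ next i ⊎ j ≡ prev i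
≢⇒next⊎prev zero zero j≢i = ⊥-elim (j≢i refl)
≢⇒next⊎prev zero (suc zero) _ = inj₁ refl
≢⇒next⊎prev zero (suc (suc zero)) _ = inj₂ refl
≢⇒next⊎prev (suc zero) zero _ = inj₂ refl
≢⇒next⊎prev (suc zero) (suc zero) j≢i = ⊥-elim (j≢i refl)
≢⇒next⊎prev (suc zero) (suc (suc zero)) _ = inj₁ refl
≢⇒next⊎prev (suc (suc zero)) zero _ = inj₁ refl
≢⇒next⊎prev (suc (suc zero)) (suc zero) _ = inj₂ refl
≢⇒next⊎prev (suc (suc zero)) (suc (suc zero)) j≢i = ⊥-elim (j≢i refl)

third : (i j : Fin 3) → i ≢ j → ∃ λ k → k ≢ i × k ≢ j
third i j i≢j with ≢⇒next⊎prev i j (i≢j ∘ sym)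
... | inj₁ refl = prev i , prev≢id i , next≢prev i ∘ sym
... | inj₂ refl = next i , next≢id i , next≢prev i

injective⇒surjective : ∀ {n} {f : Fin n → Fin n} → Injective _≡_ _≡_ f → ∀ m → ∃ λ k → f k ≡ m
injective⇒surjective {ℕ.suc n} {f} f-inj m with Fin.any? (λ k → f k Fin.≟ m)
... | yes hit = hit
... | no miss = ⊥-elim (Fin.<⇒notInjective (n<1+n n) punched-inj)
  where
  m≢f : ∀ k → m ≢ f k
  m≢f k e = miss (k , sym e)
  punched-inj : Injective _≡_ _≡_ (λ k → punchOut (m≢f k))
  punched-inj e = f-inj (Fin.punchOut-injective (m≢f _) (m≢f _) e)

module _ {G H : Graph} where
  mk≅ : (f : V G → V H) (g : V H → V G)
    → (∀ y → f (g y) ≡ y) → (∀ x → g (f x) ≡ x)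
    → (δ : Dart G → Dart H) (ε : Dart H → Dart G)
    → (∀ e → δ (ε e) ≡ e) → (∀ d → ε (δ d) ≡ d)
    → (∀ d → proj₁ (δ d) ≡ f (proj₁ d))
    → (∀ d → δ (σ G d) ≡ σ H (δ d))
    → G ≅ H
  mk≅ f g fg gf δ ε δε εδ inc edg = record
    { vmap = mk↔ₛ′ f g fg gf
    ; dmap = mk↔ₛ′ δ ε δε εδ
    ; incidence = inc
    ; edges = edg }

  mk≅-keeping-ports : (f : V G → V H) (g : V H → V G)
    → (∀ y → f (g y) ≡ y) → (∀ x → g (f x) ≡ x)
    → (∀ x k → (f (proj₁ (σ G (x , k))) , proj₂ (σ G (x , k))) ≡ σ H (f x , k))
    → G ≅ H
  mk≅-keeping-ports f g fg gf edg = mk≅ f g fg gf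
    (λ (x , k) → f x , k) (λ (y , k) → g y , k)
    (λ (y , k) → cong (_, k) (fg y))
    (λ (x , k) → cong (_, k) (gf x))
    (λ _ → refl)
    (λ (x , k) → edg x k)

module Iso {G H : Graph} (ψ : G ≅ H) where
  open _≅_ ψ

  f : V G → V H
  f = Inverse.to vmap
  g : V H → V G
  g = Inverse.from vmap
  δ : Dart G → Dart H
  δ = Inverse.to dmap
  ε : Dart H → Dart G
  ε = Inverse.from dmap

  fg : ∀ y → f (g y) ≡ y
  fg = Inverse.strictlyInverseˡ vmap
  gf : ∀ x → g (f x) ≡ x
  gf = Inverse.strictlyInverseʳ vmap
  δε : ∀ e → δ (ε e) ≡ e
  δε = Inverse.strictlyInverseˡ dmap
  εδ : ∀ d → ε (δ d) ≡ d
  εδ = Inverse.strictlyInverseʳ dmap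

  inc : ∀ d → proj₁ (δ d) ≡ f (proj₁ d)
  inc = incidence
  edg : ∀ d → δ (σ G d) ≡ σ H (δ d)
  edg = edges

  f-injective : ∀ {x y} → f x ≡ f y → x ≡ y
  f-injective {x} {y} e = trans (sym (gf x)) (trans (cong g e) (gf y))

  δ-form : ∀ d → δ d ≡ (f (proj₁ d) , proj₂ (δ d))
  δ-form d = cong (_, proj₂ (δ d)) (inc d)

  inc⁻¹ : ∀ e → proj₁ (ε e) ≡ g (proj₁ e)
  inc⁻¹ e = trans (sym (gf (proj₁ (ε e)))) (cong g (trans (sym (inc (ε e))) (cong proj₁ (δε e))))

  edg⁻¹ : ∀ e → ε (σ H e) ≡ σ G (ε e)
  edg⁻¹ e = begin
    ε (σ H e)           ≡⟨ cong (ε ∘ σ H) (sym (δε e)) ⟩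
    ε (σ H (δ (ε e)))   ≡⟨ cong ε (sym (edg (ε e))) ⟩
    ε (δ (σ G (ε e)))   ≡⟨ εδ (σ G (ε e)) ⟩
    σ G (ε e)           ∎
    where open ≡-Reasoning

  neighbour-δ : ∀ d → proj₁ (σ H (δ d)) ≡ f (proj₁ (σ G d))
  neighbour-δ d = trans (cong proj₁ (sym (edg d))) (inc (σ G d))

  neighbour-f : ∀ d → proj₁ (σ H (f (proj₁ d) , proj₂ (δ d))) ≡ f (proj₁ (σ G d))
  neighbour-f d = trans (cong (proj₁ ∘ σ H) (sym (δ-form d))) (neighbour-δ d)

  ε-form : ∀ x l → ε (f x , l) ≡ (x , proj₂ (ε (f x , l)))
  ε-form x l = cong (_, proj₂ (ε (f x , l))) (trans (inc⁻¹ (f x , l)) (gf x))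

  ε-injective : ∀ {d e} → ε d ≡ ε e → d ≡ e
  ε-injective {d} {e} eq = trans (sym (δε d)) (trans (cong δ eq) (δε e))

  f-ε : ∀ e → f (proj₁ (ε e)) ≡ proj₁ e
  f-ε e = trans (sym (inc (ε e))) (cong proj₁ (δε e))

  neighbour-ε : ∀ e → proj₁ (σ H e) ≡ f (proj₁ (σ G (ε e)))
  neighbour-ε e = trans (cong (proj₁ ∘ σ H) (sym (δε e))) (neighbour-δ (ε e))

  δε-form : ∀ x l → δ (x , proj₂ (ε (f x , l))) ≡ (f x , l)
  δε-form x l = trans (cong δ (sym (ε-form x l))) (δε (f x , l))

≅-refl : ∀ {G} → G ≅ G
≅-refl = mk≅ (λ x → x) (λ x → x) (λ _ → refl) (λ _ → refl) (λ d → d) (λ d → d)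
  (λ _ → refl) (λ _ → refl) (λ _ → refl) (λ _ → refl)

≅-sym : ∀ {G H} → G ≅ H → H ≅ G
≅-sym ψ = mk≅ g f gf fg ε δ εδ δε inc⁻¹ edg⁻¹
  where open Iso ψ

≅-trans : ∀ {A B C} → A ≅ B → B ≅ C → A ≅ C
≅-trans ψ₁ ψ₂ = mk≅ (I₂.f ∘ I₁.f) (I₁.g ∘ I₂.g)
  (λ y → trans (cong I₂.f (I₁.fg (I₂.g y))) (I₂.fg y))
  (λ x → trans (cong I₁.g (I₂.gf (I₁.f x))) (I₁.gf x))
  (I₂.δ ∘ I₁.δ) (I₁.ε ∘ I₂.ε)
  (λ e → trans (cong I₂.δ (I₁.δε (I₂.ε e))) (I₂.δε e))
  (λ d → trans (cong I₁.ε (I₂.εδ (I₁.δ d))) (I₁.εδ d))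
  (λ d → trans (I₂.inc (I₁.δ d)) (cong I₂.f (I₁.inc d)))
  (λ d → trans (cong I₂.δ (I₁.edg d)) (I₂.edg (I₁.δ d)))
  where
  module I₁ = Iso ψ₁
  module I₂ = Iso ψ₂

Klee-resp-≅ : ∀ {A B} → Klee A → A ≅ B → Klee B
Klee-resp-≅ (k4 φ) ψ = k4 (≅-trans (≅-sym ψ) φ)
Klee-resp-≅ (step H w k φ) ψ = step H w k (≅-trans (≅-sym ψ) φ)

Simple : Graph → Set
Simple X = ∀ x k l → proj₁ (σ X (x , k)) ≡ proj₁ (σ X (x , l)) → k ≡ l

IsCubic-resp-≅ : ∀ {A B} → IsCubic A → A ≅ B → IsCubic B
IsCubic-resp-≅ {A} {B} c ψ = record { invol = invol′ ; loopless = loopless′ }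
  where
  open Iso ψ
  open IsCubic c
  invol′ : ∀ e → σ B (σ B e) ≡ e
  invol′ e = begin
    σ B (σ B e)                 ≡⟨ cong (σ B ∘ σ B) (sym (δε e)) ⟩
    σ B (σ B (δ (ε e)))         ≡⟨ cong (σ B) (sym (edg (ε e))) ⟩
    σ B (δ (σ A (ε e)))         ≡⟨ sym (edg (σ A (ε e))) ⟩
    δ (σ A (σ A (ε e)))         ≡⟨ cong δ (invol (ε e)) ⟩
    δ (ε e)                     ≡⟨ δε e ⟩
    e                           ∎
    where open ≡-Reasoning
  loopless′ : ∀ e → proj₁ (σ B e) ≢ proj₁ e
  loopless′ e eq = loopless (ε e) (f-injective (trans (sym (neighbour-ε e)) (trans eq (sym (f-ε e)))))

Simple-resp-≅ : ∀ {A B} → Simple A → A ≅ B → Simple B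
Simple-resp-≅ {A} {B} s ψ y k l same = ,-injectiveʳ (ε-injective (begin
    ε (y , k)    ≡⟨ ε-at k ⟩
    (g y , k′)   ≡⟨ cong (g y ,_) k′≡l′ ⟩
    (g y , l′)   ≡⟨ sym (ε-at l) ⟩
    ε (y , l)    ∎))
  where
  open Iso ψ
  open ≡-Reasoning
  k′ l′ : Fin 3
  k′ = proj₂ (ε (y , k))
  l′ = proj₂ (ε (y , l))
  ε-at : ∀ m → ε (y , m) ≡ (g y , proj₂ (ε (y , m)))
  ε-at m = cong (_, proj₂ (ε (y , m))) (inc⁻¹ (y , m))
  k′≡l′ : k′ ≡ l′
  k′≡l′ = s (g y) k′ l′ (f-injective (begin
    f (proj₁ (σ A (g y , k′)))  ≡⟨ cong (f ∘ proj₁ ∘ σ A) (sym (ε-at k)) ⟩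
    f (proj₁ (σ A (ε (y , k)))) ≡⟨ sym (neighbour-ε (y , k)) ⟩
    proj₁ (σ B (y , k))         ≡⟨ same ⟩
    proj₁ (σ B (y , l))         ≡⟨ neighbour-ε (y , l) ⟩
    f (proj₁ (σ A (ε (y , l)))) ≡⟨ cong (f ∘ proj₁ ∘ σ A) (ε-at l) ⟩
    f (proj₁ (σ A (g y , l′)))  ∎))

module Expansion (G : Graph) (v : V G) where
  open Expand G v public

  neighbour : Fin 3 → V G
  neighbour i = proj₁ (σ G (v , i))

  σ'-corner : ∀ i j → σ' (t i , j) ≡ tri i j
  σ'-corner zero j with _≟_ G v v
  ... | yes _ = refl
  ... | no v≢v = ⊥-elim (v≢v refl)
  σ'-corner (suc i) j = refl

  σ'-corner-vertex : ∀ i j → proj₁ (σ' (t i , j)) ≡ proj₁ (tri i j)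
  σ'-corner-vertex i j = cong proj₁ (σ'-corner i j)

  σ'-old : ∀ u j → u ≢ v → σ' (inj₁ u , j) ≡ ext (σ G (u , j))
  σ'-old u j u≢v with _≟_ G u v
  ... | yes u≡v = ⊥-elim (u≢v u≡v)
  ... | no _ = refl

  ext-at-v : ∀ k → ext (v , k) ≡ (t k , zero)
  ext-at-v k with _≟_ G v v
  ... | yes _ = refl
  ... | no v≢v = ⊥-elim (v≢v refl)

  ext-away : ∀ y k → y ≢ v → ext (y , k) ≡ (inj₁ y , k)
  ext-away y k y≢v with _≟_ G y v
  ... | yes y≡v = ⊥-elim (y≢v y≡v)
  ... | no _ = refl

  ext-cases : ∀ y k → (y ≡ v × ext (y , k) ≡ (t k , zero)) ⊎ (y ≢ v × ext (y , k) ≡ (inj₁ y , k))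
  ext-cases y k = cases (_≟_ G y v)
    where
    cases : Dec (y ≡ v) → (y ≡ v × ext (y , k) ≡ (t k , zero)) ⊎ (y ≢ v × ext (y , k) ≡ (inj₁ y , k))
    cases (yes refl) = inj₁ (refl , ext-at-v k)
    cases (no y≢v) = inj₂ (y≢v , ext-away y k y≢v)

  t-injective : ∀ {i j} → t i ≡ t j → i ≡ j
  t-injective {zero} {zero} _ = refl
  t-injective {suc i} {suc j} e = cong suc (inj₂-injective e)

  inj₁≡t⇒≡v : ∀ {y i} → inj₁ y ≡ t i → y ≡ v
  inj₁≡t⇒≡v {i = zero} e = inj₁-injective e

  ext-vertex-injective : ∀ {d e} → proj₁ (ext d) ≡ proj₁ (ext e) → proj₁ d ≡ proj₁ e
  ext-vertex-injective {y , k} {z , l} eq with ext-cases y k | ext-cases z l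
  ... | inj₁ (y≡v , _) | inj₁ (z≡v , _) = trans y≡v (sym z≡v)
  ... | inj₁ (_ , e₁) | inj₂ (z≢v , e₂) =
    ⊥-elim (z≢v (inj₁≡t⇒≡v (trans (cong proj₁ (sym e₂)) (trans (sym eq) (cong proj₁ e₁)))))
  ... | inj₂ (y≢v , e₁) | inj₁ (_ , e₂) =
    ⊥-elim (y≢v (inj₁≡t⇒≡v (trans (cong proj₁ (sym e₁)) (trans eq (cong proj₁ e₂)))))
  ... | inj₂ (_ , e₁) | inj₂ (_ , e₂) =
    inj₁-injective (trans (cong proj₁ (sym e₁)) (trans eq (cong proj₁ e₂)))

  IsCorner : V' → Set
  IsCorner y = ∃ λ i → y ≡ t i

  data View : V' → Set where
    corner : ∀ i → View (t i)
    old    : ∀ u → u ≢ v → View (inj₁ u)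

  view : ∀ y → View y
  view (inj₂ i) = corner (suc i)
  view (inj₁ u) with _≟_ G u v
  ... | yes refl = corner zero
  ... | no u≢v = old u u≢v

  isCorner? : ∀ y → Dec (IsCorner y)
  isCorner? y with view y
  ... | corner i = yes (i , refl)
  ... | old u u≢v = no λ (i , e) → u≢v (inj₁≡t⇒≡v e)

  corner-exit-port : ∀ i j → ¬ IsCorner (proj₁ (tri i j)) → j ≡ zero
  corner-exit-port i zero _ = refl
  corner-exit-port i (suc zero) ¬c = ⊥-elim (¬c (next i , refl))
  corner-exit-port i (suc (suc zero)) ¬c = ⊥-elim (¬c (prev i , refl))

  data DartView : V' × Fin 3 → Set where
    image   : ∀ d → DartView (ext d)
    inner-1 : ∀ i → DartView (t i , suc zero)
    inner-2 : ∀ i → DartView (t i , suc (suc zero))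

  dartView : ∀ e → DartView e
  dartView (y , j) with view y
  dartView (.(t i) , zero) | corner i = subst DartView (ext-at-v i) (image (v , i))
  dartView (.(t i) , suc zero) | corner i = inner-1 i
  dartView (.(t i) , suc (suc zero)) | corner i = inner-2 i
  dartView (.(inj₁ u) , j) | old u u≢v = subst DartView (ext-away u j u≢v) (image (u , j))

  old-adjacent : ∀ {u y} l → u ≢ v → y ≢ v → proj₁ (σ G (u , l)) ≡ y → proj₁ (σ' (inj₁ u , l)) ≡ inj₁ y
  old-adjacent {u} {y} l u≢v y≢v refl = cong proj₁ (trans (σ'-old u l u≢v) (ext-away y _ y≢v))

  old-adjacent⁻¹ : ∀ {u y} l → u ≢ v → y ≢ v → proj₁ (σ' (inj₁ u , l)) ≡ inj₁ y → proj₁ (σ G (u , l)) ≡ y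
  old-adjacent⁻¹ {u} {y} l u≢v y≢v e = ext-vertex-injective {e = y , l}
    (trans (cong proj₁ (sym (σ'-old u l u≢v))) (trans e (cong proj₁ (sym (ext-away y l y≢v)))))

  module _ (cubic : IsCubic G) where
    open IsCubic cubic

    neighbour≢v : ∀ i → neighbour i ≢ v
    neighbour≢v i = loopless (v , i)

    σ'-ext : ∀ d → σ' (ext d) ≡ ext (σ G d)
    σ'-ext (y , k) with ext-cases y k
    ... | inj₁ (refl , e) = begin
      σ' (ext (v , k))                      ≡⟨ cong σ' e ⟩
      σ' (t k , zero)                       ≡⟨ σ'-corner k zero ⟩
      (inj₁ (neighbour k) , proj₂ (σ G (v , k))) ≡⟨ sym (ext-away _ _ (neighbour≢v k)) ⟩
      ext (σ G (v , k))                     ∎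
      where open ≡-Reasoning
    ... | inj₂ (y≢v , e) = trans (cong σ' e) (σ'-old y k y≢v)

    corner-neighbour : ∀ i → proj₁ (σ' (t i , zero)) ≡ inj₁ (neighbour i)
    corner-neighbour i = σ'-corner-vertex i zero

    corner-neighbour≢corner : ∀ i j → proj₁ (σ' (t i , zero)) ≢ t j
    corner-neighbour≢corner i j e = neighbour≢v i (inj₁≡t⇒≡v (trans (sym (corner-neighbour i)) e))

IsCubic-^ : ∀ {G} → IsCubic G → ∀ v → IsCubic (G ^ v)
IsCubic-^ {G} cubic v = record { invol = invol′ ; loopless = loopless′ }
  where
  open Expansion G v
  open IsCubic cubic
  invol′ : ∀ e → σ' (σ' e) ≡ e
  invol′ e with dartView e
  ... | image d = begin
    σ' (σ' (ext d))     ≡⟨ cong σ' (σ'-ext cubic d) ⟩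
    σ' (ext (σ G d))    ≡⟨ σ'-ext cubic (σ G d) ⟩
    ext (σ G (σ G d))   ≡⟨ cong ext (invol d) ⟩
    ext d               ∎
    where open ≡-Reasoning
  ... | inner-1 i = trans (cong σ' (σ'-corner i (suc zero)))
    (trans (σ'-corner (next i) (suc (suc zero))) (cong (λ k → t k , suc zero) (prev-next i)))
  ... | inner-2 i = trans (cong σ' (σ'-corner i (suc (suc zero))))
    (trans (σ'-corner (prev i) (suc zero)) (cong (λ k → t k , suc (suc zero)) (next-prev i)))
  loopless′ : ∀ e → proj₁ (σ' e) ≢ proj₁ e
  loopless′ e with dartView e
  ... | image d = λ eq → loopless d (ext-vertex-injective (trans (cong proj₁ (sym (σ'-ext cubic d))) eq))
  ... | inner-1 i = λ eq → next≢id i (t-injective (trans (sym (σ'-corner-vertex i (suc zero))) eq))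
  ... | inner-2 i = λ eq → prev≢id i (t-injective (trans (sym (σ'-corner-vertex i (suc (suc zero)))) eq))

Simple-^ : ∀ {G} → IsCubic G → Simple G → ∀ v → Simple (G ^ v)
Simple-^ {G} cubic simple v y k l same with Expansion.view G v y
... | Expansion.corner i =
  corner-ports k l (trans (sym (σ'-corner-vertex i k)) (trans same (σ'-corner-vertex i l)))
  where
  open Expansion G v
  corner-ports : ∀ k l → proj₁ (tri i k) ≡ proj₁ (tri i l) → k ≡ l
  corner-ports zero zero _ = refl
  corner-ports zero (suc zero) e = ⊥-elim (neighbour≢v cubic i (inj₁≡t⇒≡v e))
  corner-ports zero (suc (suc zero)) e = ⊥-elim (neighbour≢v cubic i (inj₁≡t⇒≡v e))
  corner-ports (suc zero) zero e = ⊥-elim (neighbour≢v cubic i (inj₁≡t⇒≡v (sym e)))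
  corner-ports (suc zero) (suc zero) _ = refl
  corner-ports (suc zero) (suc (suc zero)) e = ⊥-elim (next≢prev i (t-injective e))
  corner-ports (suc (suc zero)) zero e = ⊥-elim (neighbour≢v cubic i (inj₁≡t⇒≡v (sym e)))
  corner-ports (suc (suc zero)) (suc zero) e = ⊥-elim (next≢prev i (sym (t-injective e)))
  corner-ports (suc (suc zero)) (suc (suc zero)) _ = refl
... | Expansion.old u u≢v = simple u k l (ext-vertex-injective (begin
    proj₁ (ext (σ G (u , k)))   ≡⟨ cong proj₁ (sym (σ'-old u k u≢v)) ⟩
    proj₁ (σ' (inj₁ u , k))     ≡⟨ same ⟩
    proj₁ (σ' (inj₁ u , l))     ≡⟨ cong proj₁ (σ'-old u l u≢v) ⟩
    proj₁ (ext (σ G (u , l)))   ∎))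
  where
  open Expansion G v
  open ≡-Reasoning

K4-cubic : IsCubic K4
K4-cubic = record
  { invol = λ (x , k) → toWitness {a? = Fin.all? λ x → Fin.all? λ k → invol? x k} _ x k
  ; loopless = λ (x , k) → toWitness {a? = Fin.all? λ x → Fin.all? λ k → loopless? x k} _ x k }
  where
  invol? : ∀ x k → Dec (K4σ (K4σ (x , k)) ≡ (x , k))
  invol? x k = ≡-dec Fin._≟_ Fin._≟_ (K4σ (K4σ (x , k))) (x , k)
  loopless? : ∀ x k → Dec (proj₁ (K4σ (x , k)) ≢ x)
  loopless? x k = ¬? (proj₁ (K4σ (x , k)) Fin.≟ x)

K4-simple : Simple K4
K4-simple = toWitness {a? = Fin.all? λ x → Fin.all? λ k → Fin.all? λ l → simple? x k l} _
  where
  simple? : ∀ x k l → Dec (proj₁ (K4σ (x , k)) ≡ proj₁ (K4σ (x , l)) → k ≡ l)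
  simple? x k l = (proj₁ (K4σ (x , k)) Fin.≟ proj₁ (K4σ (x , l))) →-dec (k Fin.≟ l)

Klee-cubic : ∀ {X} → Klee X → IsCubic X
Klee-cubic (k4 φ) = IsCubic-resp-≅ K4-cubic (≅-sym φ)
Klee-cubic (step H w k φ) = IsCubic-resp-≅ (IsCubic-^ (Klee-cubic k) w) (≅-sym φ)

Klee-simple : ∀ {X} → Klee X → Simple X
Klee-simple (k4 φ) = Simple-resp-≅ K4-simple (≅-sym φ)
Klee-simple (step H w k φ) = Simple-resp-≅ (Simple-^ (Klee-cubic k) (Klee-simple k) w) (≅-sym φ)

record Triangle (X : Graph) : Set where
  field
    vertex           : Fin 3 → V X
    vertex-injective : ∀ {i j} → vertex i ≡ vertex j → i ≡ j
    exit             : Fin 3 → Fin 3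
    adjacent         : ∀ i j → i ≢ j → ∃ λ l → proj₁ (σ X (vertex i , l)) ≡ vertex j
    internal         : ∀ i l → l ≢ exit i → ∃ λ j → proj₁ (σ X (vertex i , l)) ≡ vertex j
    exit-leaves      : ∀ i j → proj₁ (σ X (vertex i , exit i)) ≢ vertex j

expansion-triangle : ∀ {G} → IsCubic G → ∀ v → Triangle (G ^ v)
expansion-triangle {G} cubic v = record
  { vertex = t
  ; vertex-injective = t-injective
  ; exit = λ _ → zero
  ; adjacent = adjacent
  ; internal = internal
  ; exit-leaves = corner-neighbour≢corner cubic }
  where
  open Expansion G v
  adjacent : ∀ i j → i ≢ j → ∃ λ l → proj₁ (σ' (t i , l)) ≡ t j
  adjacent i j i≢j with ≢⇒next⊎prev i j (i≢j ∘ sym)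
  ... | inj₁ refl = suc zero , σ'-corner-vertex i (suc zero)
  ... | inj₂ refl = suc (suc zero) , σ'-corner-vertex i (suc (suc zero))
  internal : ∀ i l → l ≢ zero → ∃ λ j → proj₁ (σ' (t i , l)) ≡ t j
  internal i zero l≢0 = ⊥-elim (l≢0 refl)
  internal i (suc zero) _ = next i , σ'-corner-vertex i (suc zero)
  internal i (suc (suc zero)) _ = prev i , σ'-corner-vertex i (suc (suc zero))

Triangle-map : ∀ {A B} → A ≅ B → Triangle A → Triangle B
Triangle-map {A} {B} ψ S = record
  { vertex = f ∘ vertex
  ; vertex-injective = vertex-injective ∘ f-injective
  ; exit = λ i → proj₂ (δ (vertex i , exit i))
  ; adjacent = λ i j i≢j → let (l , e) = adjacent i j i≢j in
      proj₂ (δ (vertex i , l)) , trans (neighbour-f (vertex i , l)) (cong f e)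
  ; internal = internal′
  ; exit-leaves = λ i j e → exit-leaves i j (f-injective (trans (sym (neighbour-f (vertex i , exit i))) e)) }
  where
  open Iso ψ
  open Triangle S
  internal′ : ∀ i l → l ≢ proj₂ (δ (vertex i , exit i))
    → ∃ λ j → proj₁ (σ B (f (vertex i) , l)) ≡ f (vertex j)
  internal′ i l l≢exit = j , (begin
    proj₁ (σ B (f (vertex i) , l))     ≡⟨ cong (proj₁ ∘ σ B) (sym (δε-form (vertex i) l)) ⟩
    proj₁ (σ B (δ (vertex i , m)))     ≡⟨ neighbour-δ (vertex i , m) ⟩
    f (proj₁ (σ A (vertex i , m)))     ≡⟨ cong f e ⟩
    f (vertex j)                       ∎)
    where
    open ≡-Reasoning
    m : Fin 3
    m = proj₂ (ε (f (vertex i) , l))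
    m≢exit : m ≢ exit i
    m≢exit m≡exit = l≢exit (sym (,-injectiveʳ (begin
      δ (vertex i , exit i)   ≡⟨ cong (λ k → δ (vertex i , k)) (sym m≡exit) ⟩
      δ (vertex i , m)        ≡⟨ δε-form (vertex i) l ⟩
      (f (vertex i) , l)      ∎)))
    j : Fin 3
    j = proj₁ (internal i m m≢exit)
    e : proj₁ (σ A (vertex i , m)) ≡ vertex j
    e = proj₂ (internal i m m≢exit)

module Contraction (B : Graph) (S : Triangle B) where
  open Triangle S public
  private
    _≟B_ : (x y : V B) → Dec (x ≡ y)
    _≟B_ = _≟_ B

  i0 i1 i2 : Fin 3
  i0 = zero
  i1 = suc zero
  i2 = suc (suc zero)

  -- The contracted vertex c is represented by vertex i0 of the triangle, and its
  -- port k is the exit dart of vertex k.  Keeping a vertex is a Bool, so that a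
  -- vertex of the contraction is determined by its underlying vertex (Vertex-≡).
  kept : V B → Bool
  kept x = not ⌊ vertex i1 ≟B x ⌋ ∧ not ⌊ vertex i2 ≟B x ⌋

  kept-intro : ∀ x → vertex i1 ≢ x → vertex i2 ≢ x → T (kept x)
  kept-intro x n1 n2 with vertex i1 ≟B x
  ... | yes e = n1 e
  ... | no _ with vertex i2 ≟B x
  ... | yes e = n2 e
  ... | no _ = tt

  kept⇒≢i1 : ∀ {x} → T (kept x) → vertex i1 ≢ x
  kept⇒≢i1 {x} pf e with vertex i1 ≟B x
  ... | yes _ = pf
  ... | no n = n e

  kept⇒≢i2 : ∀ {x} → T (kept x) → vertex i2 ≢ x
  kept⇒≢i2 {x} pf e with vertex i1 ≟B x
  ... | yes _ = pf
  ... | no _ with vertex i2 ≟B x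
  ... | yes _ = pf
  ... | no n = n e

  Vertex : Set
  Vertex = Σ (V B) λ x → T (kept x)

  Vertex-≡ : ∀ {x y : V B} {a : T (kept x)} {b : T (kept y)} → x ≡ y → _≡_ {A = Vertex} (x , a) (y , b)
  Vertex-≡ {x} {a = a} {b} refl = cong (x ,_) (T-irrelevant a b)

  _≟ᶜ_ : (u w : Vertex) → Dec (u ≡ w)
  (x , a) ≟ᶜ (y , b) with x ≟B y
  ... | yes e = yes (Vertex-≡ e)
  ... | no x≢y = no (x≢y ∘ cong proj₁)

  Outside : V B → Set
  Outside y = ∀ i → vertex i ≢ y

  outside-kept : ∀ {y} → Outside y → T (kept y)
  outside-kept {y} n = kept-intro y (n i1) (n i2)

  c : Vertex
  c = vertex i0 , kept-intro (vertex i0) (λ e → 1≢0 (vertex-injective e)) (λ e → 2≢0 (vertex-injective e))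
    where
    1≢0 : i1 ≢ i0
    1≢0 ()
    2≢0 : i2 ≢ i0
    2≢0 ()

  data Membership (y : V B) : Set where
    inside  : ∀ i → vertex i ≡ y → Membership y
    outside : Outside y → Membership y

  membership : ∀ y → Membership y
  membership y with vertex i0 ≟B y
  ... | yes e = inside i0 e
  ... | no n0 with vertex i1 ≟B y
  ... | yes e = inside i1 e
  ... | no n1 with vertex i2 ≟B y
  ... | yes e = inside i2 e
  ... | no n2 = outside λ { zero → n0 ; (suc zero) → n1 ; (suc (suc zero)) → n2 }

  Πv : V B → Vertex
  Πv y with membership y
  ... | inside _ _ = c
  ... | outside n = y , outside-kept n

  Πd : Dart B → Vertex × Fin 3
  Πd (y , l) with membership y
  ... | inside i _ = c , i
  ... | outside n = (y , outside-kept n) , l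

  lift : Vertex × Fin 3 → Dart B
  lift ((x , _) , k) with vertex i0 ≟B x
  ... | yes _ = vertex k , exit k
  ... | no _ = x , k

  σᶜ : Vertex × Fin 3 → Vertex × Fin 3
  σᶜ = Πd ∘ σ B ∘ lift

  graph : Graph
  graph = record { V = Vertex ; _≟_ = _≟ᶜ_ ; σ = σᶜ }

  Πd-vertex : ∀ d → proj₁ (Πd d) ≡ Πv (proj₁ d)
  Πd-vertex (y , l) with membership y
  ... | inside _ _ = refl
  ... | outside _ = refl

  Πv-inside : ∀ i → Πv (vertex i) ≡ c
  Πv-inside i with membership (vertex i)
  ... | inside _ _ = refl
  ... | outside n = ⊥-elim (n i refl)

  Πv-outside : ∀ {y} (n : Outside y) → Πv y ≡ (y , outside-kept n)
  Πv-outside {y} n with membership y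
  ... | inside j e = ⊥-elim (n j e)
  ... | outside _ = Vertex-≡ refl

  Πd-inside : ∀ i l → Πd (vertex i , l) ≡ (c , i)
  Πd-inside i l with membership (vertex i)
  ... | inside j e = cong (c ,_) (vertex-injective e)
  ... | outside n = ⊥-elim (n i refl)

  Πd-outside : ∀ {y} l (n : Outside y) → Πd (y , l) ≡ ((y , outside-kept n) , l)
  Πd-outside {y} l n with membership y
  ... | inside j e = ⊥-elim (n j e)
  ... | outside _ = cong (_, l) (Vertex-≡ refl)

  Πv≡kept⇒≡ : ∀ {y x pf} → Πv y ≡ (x , pf) → vertex i0 ≢ x → y ≡ x
  Πv≡kept⇒≡ {y} e n0 with membership y
  ... | inside _ _ = ⊥-elim (n0 (cong proj₁ e))
  ... | outside _ = cong proj₁ e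

  data VertexView : Vertex → Set where
    contracted : VertexView c
    kept-vertex : ∀ x pf → Outside x → VertexView (x , pf)

  vertexView : ∀ u → VertexView u
  vertexView (x , pf) with vertex i0 ≟B x
  ... | yes refl = subst VertexView (Vertex-≡ refl) contracted
  ... | no n0 = kept-vertex x pf
    λ { zero → n0 ; (suc zero) → kept⇒≢i1 pf ; (suc (suc zero)) → kept⇒≢i2 pf }

  lift-c : ∀ k → lift (c , k) ≡ (vertex k , exit k)
  lift-c k with vertex i0 ≟B vertex i0
  ... | yes _ = refl
  ... | no n = ⊥-elim (n refl)

  lift-kept : ∀ x pf k → vertex i0 ≢ x → lift ((x , pf) , k) ≡ (x , k)
  lift-kept x pf k n0 with vertex i0 ≟B x
  ... | yes e = ⊥-elim (n0 e)
  ... | no _ = refl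

  Outer : Dart B → Set
  Outer d = (∃ λ i → d ≡ (vertex i , exit i)) ⊎ Outside (proj₁ d)

  lift-outer : ∀ e → Outer (lift e)
  lift-outer (u , k) with vertexView u
  ... | contracted = inj₁ (k , lift-c k)
  ... | kept-vertex x pf n = inj₂ (subst (Outside ∘ proj₁) (sym (lift-kept x pf k (n i0))) n)

  lift-Πd : ∀ d → Outer d → lift (Πd d) ≡ d
  lift-Πd .(vertex i , exit i) (inj₁ (i , refl)) = trans (cong lift (Πd-inside i (exit i))) (lift-c i)
  lift-Πd (y , l) (inj₂ n) = trans (cong lift (Πd-outside l n)) (lift-kept y (outside-kept n) l (n i0))

  Πd-lift : ∀ e → Πd (lift e) ≡ e
  Πd-lift (u , k) with vertexView u
  ... | contracted = trans (cong Πd (lift-c k)) (Πd-inside k (exit k))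
  ... | kept-vertex x pf n =
    trans (cong Πd (lift-kept x pf k (n i0))) (trans (Πd-outside k n) (cong (_, k) (Vertex-≡ refl)))

  module _ (cubic : IsCubic B) where
    open IsCubic cubic

    σ-outer : ∀ d → Outer d → Outer (σ B d)
    σ-outer .(vertex i , exit i) (inj₁ (i , refl)) = inj₂ λ j e → exit-leaves i j (sym e)
    σ-outer (x , k) (inj₂ n) with σ B (x , k) in eq
    ... | (y , l) with membership y
    ... | outside n′ = inj₂ n′
    ... | inside j refl with l Fin.≟ exit j
    ... | yes refl = inj₁ (j , refl)
    ... | no l≢exit = ⊥-elim (n i (trans (sym e) (cong proj₁ back)))
      where
      i : Fin 3
      i = proj₁ (internal j l l≢exit)
      e : proj₁ (σ B (vertex j , l)) ≡ vertex i
      e = proj₂ (internal j l l≢exit)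
      back : σ B (vertex j , l) ≡ (x , k)
      back = trans (cong (σ B) (sym eq)) (invol (x , k))

    σ-lift-outer : ∀ e → Outer (σ B (lift e))
    σ-lift-outer e = σ-outer (lift e) (lift-outer e)

IsCubic-/ : ∀ {B} → IsCubic B → (S : Triangle B) → IsCubic (Contraction.graph B S)
IsCubic-/ {B} cubic S = record { invol = invol′ ; loopless = loopless′ }
  where
  open Contraction B S
  open IsCubic cubic
  invol′ : ∀ e → σᶜ (σᶜ e) ≡ e
  invol′ e = begin
    Πd (σ B (lift (Πd (σ B (lift e)))))  ≡⟨ cong (Πd ∘ σ B) (lift-Πd _ (σ-lift-outer cubic e)) ⟩
    Πd (σ B (σ B (lift e)))              ≡⟨ cong Πd (invol (lift e)) ⟩
    Πd (lift e)                          ≡⟨ Πd-lift e ⟩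
    e                                    ∎
    where open ≡-Reasoning
  loopless′ : ∀ e → proj₁ (σᶜ e) ≢ proj₁ e
  loopless′ (u , k) eq with vertexView u
  ... | contracted = exit-leaves k i0 (cong proj₁ (begin
    (y , outside-kept y-out)  ≡⟨ sym (Πv-outside y-out) ⟩
    Πv y                      ≡⟨ sym (Πd-vertex (σ B (vertex k , exit k))) ⟩
    proj₁ (Πd (σ B (vertex k , exit k))) ≡⟨ cong (proj₁ ∘ Πd ∘ σ B) (sym (lift-c k)) ⟩
    proj₁ (σᶜ (c , k))        ≡⟨ eq ⟩
    c                         ∎))
    where
    open ≡-Reasoning
    y : V B
    y = proj₁ (σ B (vertex k , exit k))
    y-out : Outside y
    y-out i e = exit-leaves k i (sym e)
  ... | kept-vertex x pf n = loopless (x , k) (Πv≡kept⇒≡ (trans (sym σ-vertex) eq) (n i0))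
    where
    σ-vertex : proj₁ (σᶜ ((x , pf) , k)) ≡ Πv (proj₁ (σ B (x , k)))
    σ-vertex = trans (Πd-vertex _) (cong (Πv ∘ proj₁ ∘ σ B) (lift-kept x pf k (n i0)))

infix 25 _/_
_/_ : (B : Graph) → Triangle B → Graph
B / S = Contraction.graph B S

module ContractionMap {B B′ : Graph} (cubic : IsCubic B) (ψ : B ≅ B′)
  (S : Triangle B) (S′ : Triangle B′) (π π⁻¹ : Fin 3 → Fin 3) (π-π⁻¹ : ∀ k → π (π⁻¹ k) ≡ k)
  (exits : ∀ i → Iso.δ ψ (Triangle.vertex S i , Triangle.exit S i)
                 ≡ (Triangle.vertex S′ (π i) , Triangle.exit S′ (π i))) where
  open Iso ψ
  module C = Contraction B S
  module C′ = Contraction B′ S′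

  f-vertex : ∀ i → f (C.vertex i) ≡ C′.vertex (π i)
  f-vertex i = trans (sym (inc _)) (cong proj₁ (exits i))

  vertex′-f : ∀ k → C′.vertex k ≡ f (C.vertex (π⁻¹ k))
  vertex′-f k = trans (cong C′.vertex (sym (π-π⁻¹ k))) (sym (f-vertex (π⁻¹ k)))

  g-vertex′ : ∀ k → g (C′.vertex k) ≡ C.vertex (π⁻¹ k)
  g-vertex′ k = trans (cong g (vertex′-f k)) (gf _)

  ε-exit′ : ∀ k → ε (C′.vertex k , C′.exit k) ≡ (C.vertex (π⁻¹ k) , C.exit (π⁻¹ k))
  ε-exit′ k = begin
    ε (C′.vertex k , C′.exit k)                       ≡⟨ cong (λ z → ε (C′.vertex z , C′.exit z)) (sym (π-π⁻¹ k)) ⟩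
    ε (C′.vertex (π (π⁻¹ k)) , C′.exit (π (π⁻¹ k)))   ≡⟨ cong ε (sym (exits (π⁻¹ k))) ⟩
    ε (δ (C.vertex (π⁻¹ k) , C.exit (π⁻¹ k)))         ≡⟨ εδ _ ⟩
    (C.vertex (π⁻¹ k) , C.exit (π⁻¹ k))               ∎
    where open ≡-Reasoning

  f-outside : ∀ {x} → C.Outside x → C′.Outside (f x)
  f-outside n k e = n (π⁻¹ k) (f-injective (trans (sym (vertex′-f k)) e))

  g-outside : ∀ {y} → C′.Outside y → C.Outside (g y)
  g-outside {y} n i e = n (π i) (trans (sym (f-vertex i)) (trans (cong f e) (fg y)))

  δ-outer : ∀ d → C.Outer d → C′.Outer (δ d)
  δ-outer .(C.vertex i , C.exit i) (inj₁ (i , refl)) = inj₁ (π i , exits i)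
  δ-outer d (inj₂ n) = inj₂ λ k e → f-outside n k (trans e (inc d))

  ε-outer : ∀ e → C′.Outer e → C.Outer (ε e)
  ε-outer .(C′.vertex k , C′.exit k) (inj₁ (k , refl)) = inj₁ (π⁻¹ k , ε-exit′ k)
  ε-outer e (inj₂ n) = inj₂ λ i eq → g-outside n i (trans eq (inc⁻¹ e))

  Fv : C.Vertex → C′.Vertex
  Fv u = C′.Πv (f (proj₁ u))
  Gv : C′.Vertex → C.Vertex
  Gv u = C.Πv (g (proj₁ u))
  Fd : C.Vertex × Fin 3 → C′.Vertex × Fin 3
  Fd = C′.Πd ∘ δ ∘ C.lift
  Gd : C′.Vertex × Fin 3 → C.Vertex × Fin 3
  Gd = C.Πd ∘ ε ∘ C′.lift

  Fv-c : Fv C.c ≡ C′.c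
  Fv-c = trans (cong C′.Πv (f-vertex zero)) (C′.Πv-inside (π zero))

  FG : ∀ u → Fv (Gv u) ≡ u
  FG u with C′.vertexView u
  ... | C′.contracted = trans (cong (C′.Πv ∘ f ∘ proj₁ ∘ C.Πv) (g-vertex′ zero))
                        (trans (cong (C′.Πv ∘ f ∘ proj₁) (C.Πv-inside (π⁻¹ zero))) Fv-c)
  ... | C′.kept-vertex y pf n = trans (cong (C′.Πv ∘ f ∘ proj₁) (C.Πv-outside (g-outside n)))
                                (trans (cong C′.Πv (fg y)) (trans (C′.Πv-outside n) (C′.Vertex-≡ refl)))

  GF : ∀ u → Gv (Fv u) ≡ u
  GF u with C.vertexView u
  ... | C.contracted = trans (cong (C.Πv ∘ g ∘ proj₁ ∘ C′.Πv) (f-vertex zero))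
                       (trans (cong (C.Πv ∘ g ∘ proj₁) (C′.Πv-inside (π zero)))
                       (trans (cong C.Πv (g-vertex′ zero)) (C.Πv-inside _)))
  ... | C.kept-vertex x pf n = trans (cong (C.Πv ∘ g ∘ proj₁) (C′.Πv-outside (f-outside n)))
                               (trans (cong C.Πv (gf x)) (trans (C.Πv-outside n) (C.Vertex-≡ refl)))

  FGd : ∀ e → Fd (Gd e) ≡ e
  FGd e = trans (cong (C′.Πd ∘ δ) (C.lift-Πd _ (ε-outer _ (C′.lift-outer e))))
          (trans (cong C′.Πd (δε _)) (C′.Πd-lift e))

  GFd : ∀ d → Gd (Fd d) ≡ d
  GFd d = trans (cong (C.Πd ∘ ε) (C′.lift-Πd _ (δ-outer _ (C.lift-outer d))))
          (trans (cong C.Πd (εδ _)) (C.Πd-lift d))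

  Fd-vertex : ∀ d → proj₁ (Fd d) ≡ Fv (proj₁ d)
  Fd-vertex (u , k) with C.vertexView u
  ... | C.contracted = begin
    proj₁ (C′.Πd (δ (C.lift (C.c , k))))   ≡⟨ C′.Πd-vertex _ ⟩
    C′.Πv (proj₁ (δ (C.lift (C.c , k))))   ≡⟨ cong (C′.Πv ∘ proj₁ ∘ δ) (C.lift-c k) ⟩
    C′.Πv (proj₁ (δ (C.vertex k , C.exit k))) ≡⟨ cong (C′.Πv ∘ proj₁) (exits k) ⟩
    C′.Πv (C′.vertex (π k))                ≡⟨ C′.Πv-inside (π k) ⟩
    C′.c                                   ≡⟨ sym Fv-c ⟩
    Fv C.c                                 ∎
    where open ≡-Reasoning
  ... | C.kept-vertex x pf n = trans (C′.Πd-vertex _)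
    (trans (cong (C′.Πv ∘ proj₁ ∘ δ) (C.lift-kept x pf k (n zero))) (cong C′.Πv (inc _)))

  Fd-σ : ∀ d → Fd (C.σᶜ d) ≡ C′.σᶜ (Fd d)
  Fd-σ d = begin
    C′.Πd (δ (C.lift (C.Πd (σ B (C.lift d)))))
      ≡⟨ cong (C′.Πd ∘ δ) (C.lift-Πd _ (C.σ-lift-outer cubic d)) ⟩
    C′.Πd (δ (σ B (C.lift d)))
      ≡⟨ cong C′.Πd (edg (C.lift d)) ⟩
    C′.Πd (σ B′ (δ (C.lift d)))
      ≡⟨ cong (C′.Πd ∘ σ B′) (sym (C′.lift-Πd _ (δ-outer _ (C.lift-outer d)))) ⟩
    C′.Πd (σ B′ (C′.lift (C′.Πd (δ (C.lift d))))) ∎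
    where open ≡-Reasoning

  iso : B / S ≅ B′ / S′
  iso = mk≅ Fv Gv FG GF Fd Gd FGd GFd Fd-vertex Fd-σ

contract-expansion : ∀ {H} (cubic : IsCubic H) w → (H ^ w) / expansion-triangle cubic w ≅ H
contract-expansion {H} cubic w = mk≅-keeping-ports Fv Gv (λ _ → refl) GF Fv-σ
  where
  open Expansion H w
  module Q = Contraction (H ^ w) (expansion-triangle cubic w)

  Fv : Q.Vertex → V H
  Fv (inj₁ h , _) = h
  Fv (inj₂ _ , _) = w

  Gv : V H → Q.Vertex
  Gv h = inj₁ h , tt

  GF : ∀ u → Gv (Fv u) ≡ u
  GF (inj₁ h , pf) = Q.Vertex-≡ refl
  GF (inj₂ zero , pf) = ⊥-elim (Q.kept⇒≢i1 pf refl)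
  GF (inj₂ (suc zero) , pf) = ⊥-elim (Q.kept⇒≢i2 pf refl)

  lift-ext : ∀ u k → Q.lift (u , k) ≡ ext (Fv u , k)
  lift-ext u k with Q.vertexView u
  ... | Q.contracted = trans (Q.lift-c k) (sym (ext-at-v k))
  ... | Q.kept-vertex (inj₁ h) pf n =
    trans (Q.lift-kept _ pf k (n zero)) (sym (ext-away h k (n zero ∘ cong inj₁ ∘ sym)))
  ... | Q.kept-vertex (inj₂ i) pf n = ⊥-elim (n (suc i) refl)

  FvD : Q.Vertex × Fin 3 → Dart H
  FvD (u , k) = Fv u , k

  Πd-ext : ∀ d → FvD (Q.Πd (ext d)) ≡ d
  Πd-ext (y , l) with ext-cases y l
  ... | inj₁ (refl , e) = cong FvD (trans (cong Q.Πd e) (Q.Πd-inside l zero))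
  ... | inj₂ (y≢w , e) = cong FvD (trans (cong Q.Πd e) (Q.Πd-outside l y-out))
    where
    y-out : Q.Outside (inj₁ y)
    y-out i e′ = y≢w (inj₁≡t⇒≡v (sym e′))

  Fv-σ : ∀ u k → FvD (Q.σᶜ (u , k)) ≡ σ H (Fv u , k)
  Fv-σ u k = begin
    FvD (Q.Πd (σ' (Q.lift (u , k))))    ≡⟨ cong (FvD ∘ Q.Πd ∘ σ') (lift-ext u k) ⟩
    FvD (Q.Πd (σ' (ext (Fv u , k))))    ≡⟨ cong (FvD ∘ Q.Πd) (σ'-ext cubic (Fv u , k)) ⟩
    FvD (Q.Πd (ext (σ H (Fv u , k))))   ≡⟨ Πd-ext (σ H (Fv u , k)) ⟩
    σ H (Fv u , k)                      ∎
    where open ≡-Reasoning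

module ExpandContract {H : Graph} (cubic : IsCubic H) (w : V H) (S : Triangle H)
  (avoid : ∀ i → Triangle.vertex S i ≢ w) where
  open Expansion H w
  open Triangle S

  S↑ : Triangle (H ^ w)
  S↑ = record
    { vertex = inj₁ ∘ vertex
    ; vertex-injective = vertex-injective ∘ inj₁-injective
    ; exit = exit
    ; adjacent = λ i j i≢j → let (l , e) = adjacent i j i≢j in
        l , old-adjacent l (avoid i) (avoid j) e
    ; internal = λ i l l≢exit → let (j , e) = internal i l l≢exit in
        j , old-adjacent l (avoid i) (avoid j) e
    ; exit-leaves = λ i j e → exit-leaves i j (old-adjacent⁻¹ (exit i) (avoid i) (avoid j) e) }

  module K = Contraction H S
  module Q = Contraction (H ^ w) S↑

  Z : Graph
  Z = H / S

  w* : K.Vertex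
  w* = w , K.outside-kept avoid

  module E = Expansion Z w*

  kept↓ : ∀ y → T (Q.kept (inj₁ y)) → K.Vertex
  kept↓ y pf = y , K.kept-intro y (Q.kept⇒≢i1 pf ∘ cong inj₁) (Q.kept⇒≢i2 pf ∘ cong inj₁)

  Fv : Q.Vertex → V (Z ^ w*)
  Fv (inj₁ y , pf) = inj₁ (kept↓ y pf)
  Fv (inj₂ i , _) = inj₂ i

  Gv : V (Z ^ w*) → Q.Vertex
  Gv (inj₁ (y , pf)) =
    inj₁ y , Q.kept-intro (inj₁ y) (K.kept⇒≢i1 pf ∘ inj₁-injective) (K.kept⇒≢i2 pf ∘ inj₁-injective)
  Gv (inj₂ i) = inj₂ i , Q.kept-intro (inj₂ i) (λ ()) (λ ())

  FG : ∀ u → Fv (Gv u) ≡ u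
  FG (inj₁ (y , pf)) = cong inj₁ (K.Vertex-≡ refl)
  FG (inj₂ i) = refl

  GF : ∀ u → Gv (Fv u) ≡ u
  GF (inj₁ y , pf) = Q.Vertex-≡ refl
  GF (inj₂ i , pf) = Q.Vertex-≡ refl

  Φ : Q.Vertex × Fin 3 → V (Z ^ w*) × Fin 3
  Φ (u , k) = Fv u , k

  K-c≢w* : K.c ≢ w*
  K-c≢w* e = avoid zero (cong proj₁ e)

  Fv-c : Fv Q.c ≡ inj₁ K.c
  Fv-c = cong inj₁ (K.Vertex-≡ refl)

  Fv-t : ∀ i pf → Fv (t i , pf) ≡ E.t i
  Fv-t zero pf = cong inj₁ (K.Vertex-≡ refl)
  Fv-t (suc i) pf = refl

  corner-outside : ∀ i → Q.Outside (t i)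
  corner-outside i j e = avoid j (inj₁≡t⇒≡v e)

  Φ-Πd-t : ∀ i l → Φ (Q.Πd (t i , l)) ≡ (E.t i , l)
  Φ-Πd-t i l = trans (cong Φ (Q.Πd-outside l (corner-outside i))) (cong (_, l) (Fv-t i _))

  Φ-Πd-internal : ∀ i k → Φ (Q.Πd (tri i (suc k))) ≡ E.tri i (suc k)
  Φ-Πd-internal i zero = Φ-Πd-t (next i) (suc (suc zero))
  Φ-Πd-internal i (suc zero) = Φ-Πd-t (prev i) (suc zero)

  Φ-Πd-ext : ∀ d → Φ (Q.Πd (ext d)) ≡ E.ext (K.Πd d)
  Φ-Πd-ext (y , l) with ext-cases y l
  ... | inj₁ (refl , e) = begin
    Φ (Q.Πd (ext (w , l)))   ≡⟨ cong (Φ ∘ Q.Πd) e ⟩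
    Φ (Q.Πd (t l , zero))    ≡⟨ Φ-Πd-t l zero ⟩
    (E.t l , zero)           ≡⟨ sym (E.ext-at-v l) ⟩
    E.ext (w* , l)           ≡⟨ cong E.ext (sym (K.Πd-outside l avoid)) ⟩
    E.ext (K.Πd (w , l))     ∎
    where open ≡-Reasoning
  ... | inj₂ (y≢w , e) with K.membership y
  ...   | K.inside j refl = begin
    Φ (Q.Πd (ext (vertex j , l)))    ≡⟨ cong (Φ ∘ Q.Πd) e ⟩
    Φ (Q.Πd (inj₁ (vertex j) , l))   ≡⟨ cong Φ (Q.Πd-inside j l) ⟩
    (Fv Q.c , j)                     ≡⟨ cong (_, j) Fv-c ⟩
    (inj₁ K.c , j)                   ≡⟨ sym (E.ext-away K.c j K-c≢w*) ⟩
    E.ext (K.c , j)                  ∎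
    where open ≡-Reasoning
  ...   | K.outside n = begin
    Φ (Q.Πd (ext (y , l)))           ≡⟨ cong (Φ ∘ Q.Πd) e ⟩
    Φ (Q.Πd (inj₁ y , l))            ≡⟨ cong Φ (Q.Πd-outside l (λ i → n i ∘ inj₁-injective)) ⟩
    (inj₁ y↓ , l)                    ≡⟨ cong (λ u → inj₁ u , l) (K.Vertex-≡ refl) ⟩
    (inj₁ (y , K.outside-kept n) , l) ≡⟨ sym (E.ext-away _ l (y≢w ∘ cong proj₁)) ⟩
    E.ext ((y , K.outside-kept n) , l) ∎
    where
    open ≡-Reasoning
    y↓ : K.Vertex
    y↓ = kept↓ y (Q.outside-kept (λ i → n i ∘ inj₁-injective))

  -- Both sides are computed from σ H, by expanding then contracting on the left and
  -- by contracting then expanding on the right; Φ-Πd-ext says the two orders agree.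
  image-σ : ∀ e d → Q.lift e ≡ ext (K.lift d) → Φ e ≡ E.ext d → Φ (Q.σᶜ e) ≡ E.σ' (Φ e)
  image-σ e d lift≡ Φ≡ = begin
    Φ (Q.Πd (σ' (Q.lift e)))            ≡⟨ cong (Φ ∘ Q.Πd ∘ σ') lift≡ ⟩
    Φ (Q.Πd (σ' (ext (K.lift d))))      ≡⟨ cong (Φ ∘ Q.Πd) (σ'-ext cubic (K.lift d)) ⟩
    Φ (Q.Πd (ext (σ H (K.lift d))))     ≡⟨ Φ-Πd-ext (σ H (K.lift d)) ⟩
    E.ext (σ Z d)                       ≡⟨ sym (E.σ'-ext (IsCubic-/ cubic S) d) ⟩
    E.σ' (E.ext d)                      ≡⟨ cong E.σ' (sym Φ≡) ⟩
    E.σ' (Φ e)                          ∎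
    where open ≡-Reasoning

  Φ-σ : ∀ u k → Φ (Q.σᶜ (u , k)) ≡ E.σ' (Fv u , k)
  Φ-σ u k with Q.vertexView u
  ... | Q.contracted = image-σ (Q.c , k) (K.c , k)
    (trans (Q.lift-c k) (trans (sym (ext-away _ _ (avoid k))) (cong ext (sym (K.lift-c k)))))
    (trans (cong (_, k) Fv-c) (sym (E.ext-away K.c k K-c≢w*)))
  ... | Q.kept-vertex x pf n with view x
  ...   | old h h≢w = image-σ ((inj₁ h , pf) , k) (kept↓ h pf , k)
    (trans (Q.lift-kept _ pf k (n zero))
      (trans (sym (ext-away h k h≢w))
        (cong ext (sym (K.lift-kept h (proj₂ (kept↓ h pf)) k (n zero ∘ cong inj₁))))))
    (sym (E.ext-away _ k (h≢w ∘ cong proj₁)))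
  ...   | corner i = corner-σ k
    where
    lift-corner : ∀ k → Q.lift ((t i , pf) , k) ≡ (t i , k)
    lift-corner k = Q.lift-kept _ pf k (n zero)
    corner-σ : ∀ k → Φ (Q.σᶜ ((t i , pf) , k)) ≡ E.σ' (Fv (t i , pf) , k)
    corner-σ zero = image-σ ((t i , pf) , zero) (w* , i)
      (trans (lift-corner zero)
        (trans (sym (ext-at-v i)) (cong ext (sym (K.lift-kept w (proj₂ w*) i (avoid zero))))))
      (trans (cong (_, zero) (Fv-t i pf)) (sym (E.ext-at-v i)))
    corner-σ (suc k) = begin
      Φ (Q.Πd (σ' (Q.lift ((t i , pf) , suc k))))  ≡⟨ cong (Φ ∘ Q.Πd ∘ σ') (lift-corner (suc k)) ⟩
      Φ (Q.Πd (σ' (t i , suc k)))                  ≡⟨ cong (Φ ∘ Q.Πd) (σ'-corner i (suc k)) ⟩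
      Φ (Q.Πd (tri i (suc k)))                     ≡⟨ Φ-Πd-internal i k ⟩
      E.tri i (suc k)                              ≡⟨ sym (E.σ'-corner i (suc k)) ⟩
      E.σ' (E.t i , suc k)                         ≡⟨ cong (λ u → E.σ' (u , suc k)) (sym (Fv-t i pf)) ⟩
      E.σ' (Fv (t i , pf) , suc k)                 ∎
      where open ≡-Reasoning

  iso : (H ^ w) / S↑ ≅ (Z ^ w*)
  iso = mk≅-keeping-ports Fv Gv FG GF Φ-σ

module TrianglesOfExpansion {H : Graph} (cubic : IsCubic H) (simple : Simple H) (w : V H)
  (S : Triangle (H ^ w)) where
  open Expansion H w
  open Triangle S

  corner-leaves-to-neighbour : ∀ j {l y} → ¬ IsCorner y → proj₁ (σ' (t j , l)) ≡ y → y ≡ inj₁ (neighbour j)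
  corner-leaves-to-neighbour j {l} {y} ¬c e with corner-exit-port j l (¬c ∘ subst IsCorner tri≡y)
    where
    tri≡y : proj₁ (tri j l) ≡ y
    tri≡y = trans (sym (σ'-corner-vertex j l)) e
  ... | refl = trans (sym e) (corner-neighbour cubic j)

  old-vertex-is-neighbour : ∀ {a b j} → vertex a ≡ t j → a ≢ b → ¬ IsCorner (vertex b)
    → vertex b ≡ inj₁ (neighbour j)
  old-vertex-is-neighbour {a} {b} a≡t a≢b ¬c = let (l , e) = adjacent a b a≢b in
    corner-leaves-to-neighbour _ ¬c (trans (cong (λ z → proj₁ (σ' (z , l))) (sym a≡t)) e)

  -- A corner t j has a single neighbour outside the new triangle; as H is
  -- simple, distinct corners have distinct such neighbours.
  no-mixed : ∀ i i′ → i ≢ i′ → IsCorner (vertex i) → ¬ IsCorner (vertex i′) → ⊥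
  no-mixed i i′ i≢i′ (j , i≡t) ¬c′ with third i i′ i≢i′
  ... | (k , k≢i , k≢i′) with isCorner? (vertex k)
  ... | yes (j′ , k≡t) = k≢i (vertex-injective (trans k≡t (trans (cong t (sym j≡j′)) (sym i≡t))))
    where
    j≡j′ : j ≡ j′
    j≡j′ = simple w j j′ (inj₁-injective (trans (sym (old-vertex-is-neighbour i≡t i≢i′ ¬c′))
                                                (old-vertex-is-neighbour k≡t k≢i′ ¬c′)))
  ... | no ¬c = k≢i′ (vertex-injective (trans (old-vertex-is-neighbour i≡t (k≢i ∘ sym) ¬c)
                                              (sym (old-vertex-is-neighbour i≡t i≢i′ ¬c′))))

  new-or-disjoint : (∀ i → IsCorner (vertex i)) ⊎ (∀ i → ¬ IsCorner (vertex i))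
  new-or-disjoint
    with isCorner? (vertex zero) | isCorner? (vertex (suc zero)) | isCorner? (vertex (suc (suc zero)))
  ... | yes a | yes b | yes c = inj₁ λ { zero → a ; (suc zero) → b ; (suc (suc zero)) → c }
  ... | no a | no b | no c = inj₂ λ { zero → a ; (suc zero) → b ; (suc (suc zero)) → c }
  ... | yes a | no b | _ = ⊥-elim (no-mixed zero (suc zero) (λ ()) a b)
  ... | yes a | yes b | no c = ⊥-elim (no-mixed zero (suc (suc zero)) (λ ()) a c)
  ... | no a | yes b | _ = ⊥-elim (no-mixed (suc zero) zero (λ ()) b a)
  ... | no a | no b | yes c = ⊥-elim (no-mixed (suc (suc zero)) zero (λ ()) c a)

  module New (corners : ∀ i → IsCorner (vertex i)) where
    π : Fin 3 → Fin 3
    π i = proj₁ (corners i)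

    vertex≡t : ∀ i → vertex i ≡ t (π i)
    vertex≡t i = proj₂ (corners i)

    π-injective : Injective _≡_ _≡_ π
    π-injective {a} {b} e = vertex-injective (trans (vertex≡t a) (trans (cong t e) (sym (vertex≡t b))))

    π⁻¹ : Fin 3 → Fin 3
    π⁻¹ m = proj₁ (injective⇒surjective π-injective m)

    π-π⁻¹ : ∀ m → π (π⁻¹ m) ≡ m
    π-π⁻¹ m = proj₂ (injective⇒surjective π-injective m)

    exit≡0 : ∀ i → exit i ≡ zero
    exit≡0 i = corner-exit-port (π i) (exit i) λ (m , e) → exit-leaves i (π⁻¹ m) (begin
      proj₁ (σ' (vertex i , exit i))    ≡⟨ cong (λ z → proj₁ (σ' (z , exit i))) (vertex≡t i) ⟩
      proj₁ (σ' (t (π i) , exit i))     ≡⟨ σ'-corner-vertex (π i) (exit i) ⟩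
      proj₁ (tri (π i) (exit i))        ≡⟨ e ⟩
      t m                               ≡⟨ cong t (sym (π-π⁻¹ m)) ⟩
      t (π (π⁻¹ m))                     ≡⟨ sym (vertex≡t (π⁻¹ m)) ⟩
      vertex (π⁻¹ m)                    ∎)
      where open ≡-Reasoning

  module Disjoint (¬corners : ∀ i → ¬ IsCorner (vertex i)) where
    old-of : ∀ y → ¬ IsCorner y → ∃ λ u → y ≡ inj₁ u × u ≢ w
    old-of y ¬c with view y
    ... | corner i = ⊥-elim (¬c (i , refl))
    ... | old u u≢w = u , refl , u≢w

    vertex↓ : Fin 3 → V H
    vertex↓ i = proj₁ (old-of (vertex i) (¬corners i))

    vertex≡inj₁ : ∀ i → vertex i ≡ inj₁ (vertex↓ i)
    vertex≡inj₁ i = proj₁ (proj₂ (old-of (vertex i) (¬corners i)))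

    avoid : ∀ i → vertex↓ i ≢ w
    avoid i = proj₂ (proj₂ (old-of (vertex i) (¬corners i)))

    neighbour↓ : ∀ i l → proj₁ (σ' (inj₁ (vertex↓ i) , l)) ≡ proj₁ (σ' (vertex i , l))
    neighbour↓ i l = cong (λ z → proj₁ (σ' (z , l))) (sym (vertex≡inj₁ i))

    down : ∀ i j l → proj₁ (σ' (vertex i , l)) ≡ vertex j → proj₁ (σ H (vertex↓ i , l)) ≡ vertex↓ j
    down i j l e = old-adjacent⁻¹ l (avoid i) (avoid j) (trans (neighbour↓ i l) (trans e (vertex≡inj₁ j)))

    S↓ : Triangle H
    S↓ = record
      { vertex = vertex↓
      ; vertex-injective = λ e →
          vertex-injective (trans (vertex≡inj₁ _) (trans (cong inj₁ e) (sym (vertex≡inj₁ _))))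
      ; exit = exit
      ; adjacent = λ i j i≢j → let (l , e) = adjacent i j i≢j in l , down i j l e
      ; internal = λ i l l≢exit → let (j , e) = internal i l l≢exit in j , down i j l e
      ; exit-leaves = λ i j e → exit-leaves i j (begin
          proj₁ (σ' (vertex i , exit i))          ≡⟨ sym (neighbour↓ i (exit i)) ⟩
          proj₁ (σ' (inj₁ (vertex↓ i) , exit i))  ≡⟨ old-adjacent (exit i) (avoid i) (avoid j) e ⟩
          inj₁ (vertex↓ j)                        ≡⟨ sym (vertex≡inj₁ j) ⟩
          vertex j                                ∎) }
      where open ≡-Reasoning

Small : Graph → Set
Small Y = Σ (V Y) λ a → Σ (V Y) λ b → ∀ x → x ≡ a ⊎ x ≡ b

Small-resp-≅ : ∀ {A B} → Small A → A ≅ B → Small B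
Small-resp-≅ (a , b , a⊎b) ψ = f a , f b , λ y → Sum.map (fg-side y) (fg-side y) (a⊎b (g y))
  where
  open Iso ψ
  fg-side : ∀ y {x} → g y ≡ x → y ≡ f x
  fg-side y e = trans (sym (fg y)) (cong f e)

no-three-in-pair : ∀ {A : Set} {a b x y z : A} → x ≡ a ⊎ x ≡ b → y ≡ a ⊎ y ≡ b → z ≡ a ⊎ z ≡ b
  → x ≢ y → x ≢ z → y ≢ z → ⊥
no-three-in-pair (inj₁ ex) (inj₁ ey) _ x≢y _ _ = x≢y (trans ex (sym ey))
no-three-in-pair (inj₂ ex) (inj₂ ey) _ x≢y _ _ = x≢y (trans ex (sym ey))
no-three-in-pair (inj₁ ex) (inj₂ ey) (inj₁ ez) _ x≢z _ = x≢z (trans ex (sym ez))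
no-three-in-pair (inj₁ ex) (inj₂ ey) (inj₂ ez) _ _ y≢z = y≢z (trans ey (sym ez))
no-three-in-pair (inj₂ ex) (inj₁ ey) (inj₁ ez) _ _ y≢z = y≢z (trans ey (sym ez))
no-three-in-pair (inj₂ ex) (inj₁ ey) (inj₂ ez) _ x≢z _ = x≢z (trans ex (sym ez))

¬Small : ∀ {G n} → HasOrder G n → 3 ≤ n → ¬ Small G
¬Small {G} {ℕ.suc (ℕ.suc (ℕ.suc m))} ord (s≤s (s≤s (s≤s _))) (_ , _ , a⊎b) =
  no-three-in-pair (a⊎b (from zero)) (a⊎b (from (suc zero))) (a⊎b (from (suc (suc zero))))
    ((λ ()) ∘ from-injective) ((λ ()) ∘ from-injective) ((λ ()) ∘ from-injective)
  where
  from : Fin (ℕ.suc (ℕ.suc (ℕ.suc m))) → V G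
  from = Inverse.from ord
  from-injective : ∀ {i j} → from i ≡ from j → i ≡ j
  from-injective {i} {j} e = trans (sym (Inverse.strictlyInverseˡ ord i))
                                   (trans (cong (Inverse.to ord) e) (Inverse.strictlyInverseˡ ord j))

swap12 : Fin 3 → Fin 3
swap12 zero = zero
swap12 (suc zero) = suc (suc zero)
swap12 (suc (suc zero)) = suc zero

swap12-involutive : ∀ k → swap12 (swap12 k) ≡ k
swap12-involutive zero = refl
swap12-involutive (suc zero) = refl
swap12-involutive (suc (suc zero)) = refl

-- Port relabelling at corner t i that makes the triangle of an expansion
-- match the vertices 1, 2, 3 of K4.
K4-port : Fin 3 → Fin 3 → Fin 3
K4-port (suc zero) = swap12
K4-port _ = λ k → k

module ExpandSmall {Y : Graph} (cubic : IsCubic Y) (small : Small Y) (y : V Y) where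
  open IsCubic cubic
  open Expansion Y y

  z : V Y
  z = neighbour zero

  z≢y : z ≢ y
  z≢y = loopless (y , zero)

  y⊎z : ∀ x → x ≡ y ⊎ x ≡ z
  y⊎z x with _≟_ Y x y | _≟_ Y x z
  ... | yes e | _ = inj₁ e
  ... | no _ | yes e = inj₂ e
  ... | no x≢y | no x≢z = ⊥-elim (no-three-in-pair (a⊎b x) (a⊎b y) (a⊎b z) x≢y x≢z (z≢y ∘ sym))
    where
    a⊎b : ∀ x → x ≡ proj₁ small ⊎ x ≡ proj₁ (proj₂ small)
    a⊎b = proj₂ (proj₂ small)

  neighbour≡z : ∀ i → neighbour i ≡ z
  neighbour≡z i with y⊎z (neighbour i)
  ... | inj₁ e = ⊥-elim (loopless (y , i) e)
  ... | inj₂ e = e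

  z-neighbour≡y : ∀ k → proj₁ (σ Y (z , k)) ≡ y
  z-neighbour≡y k with y⊎z (proj₁ (σ Y (z , k)))
  ... | inj₁ e = e
  ... | inj₂ e = ⊥-elim (loopless (z , k) e)

  σ-zy : ∀ i → σ Y (z , proj₂ (σ Y (y , i))) ≡ (y , i)
  σ-zy i = trans (cong (λ u → σ Y (u , proj₂ (σ Y (y , i)))) (sym (neighbour≡z i))) (invol (y , i))

  σ-yz : ∀ k → σ Y (y , proj₂ (σ Y (z , k))) ≡ (z , k)
  σ-yz k = trans (cong (λ u → σ Y (u , proj₂ (σ Y (z , k)))) (sym (z-neighbour≡y k))) (invol (z , k))

  Fv : V' → Fin 4
  Fv (inj₁ x) with _≟_ Y x y
  ... | yes _ = suc zero
  ... | no _ = zero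
  Fv (inj₂ i) = suc (suc i)

  Gv : Fin 4 → V'
  Gv zero = inj₁ z
  Gv (suc i) = t i

  Fd : V' × Fin 3 → Fin 4 × Fin 3
  Fd (inj₁ x , k) with _≟_ Y x y
  ... | yes _ = suc zero , k
  ... | no _ = zero , proj₂ (σ Y (x , k))
  Fd (inj₂ i , k) = suc (suc i) , K4-port (suc i) k

  Gd : Fin 4 × Fin 3 → V' × Fin 3
  Gd (zero , m) = inj₁ z , proj₂ (σ Y (y , m))
  Gd (suc i , k) = t i , K4-port i k

  Fv-t : ∀ i → Fv (t i) ≡ suc i
  Fv-t zero with _≟_ Y y y
  ... | yes _ = refl
  ... | no y≢y = ⊥-elim (y≢y refl)
  Fv-t (suc i) = refl

  Fv-z : Fv (inj₁ z) ≡ zero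
  Fv-z with _≟_ Y z y
  ... | yes e = ⊥-elim (z≢y e)
  ... | no _ = refl

  Fd-t : ∀ i k → Fd (t i , k) ≡ (suc i , K4-port i k)
  Fd-t zero k with _≟_ Y y y
  ... | yes _ = refl
  ... | no y≢y = ⊥-elim (y≢y refl)
  Fd-t (suc i) k = refl

  Fd-z : ∀ k → Fd (inj₁ z , k) ≡ (zero , proj₂ (σ Y (z , k)))
  Fd-z k with _≟_ Y z y
  ... | yes e = ⊥-elim (z≢y e)
  ... | no _ = refl

  K4-port-involutive : ∀ i k → K4-port i (K4-port i k) ≡ k
  K4-port-involutive zero k = refl
  K4-port-involutive (suc zero) k = swap12-involutive k
  K4-port-involutive (suc (suc zero)) k = refl

  FG : ∀ a → Fv (Gv a) ≡ a
  FG zero = Fv-z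
  FG (suc i) = Fv-t i

  GF : ∀ u → Gv (Fv u) ≡ u
  GF u with view u
  ... | corner i = cong Gv (Fv-t i)
  ... | old x x≢y with y⊎z x
  ...   | inj₁ x≡y = ⊥-elim (x≢y x≡y)
  ...   | inj₂ refl = cong Gv Fv-z

  FGd : ∀ e → Fd (Gd e) ≡ e
  FGd (zero , m) = trans (Fd-z _) (cong (zero ,_) (cong proj₂ (σ-zy m)))
  FGd (suc i , k) = trans (Fd-t i _) (cong (suc i ,_) (K4-port-involutive i k))

  GFd : ∀ d → Gd (Fd d) ≡ d
  GFd (u , k) with view u
  ... | corner i = trans (cong Gd (Fd-t i k)) (cong (t i ,_) (K4-port-involutive i k))
  ... | old x x≢y with y⊎z x
  ...   | inj₁ x≡y = ⊥-elim (x≢y x≡y)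
  ...   | inj₂ refl = trans (cong Gd (Fd-z k)) (cong (inj₁ z ,_) (cong proj₂ (σ-yz k)))

  Fd-vertex : ∀ d → proj₁ (Fd d) ≡ Fv (proj₁ d)
  Fd-vertex (inj₁ x , k) with _≟_ Y x y
  ... | yes _ = refl
  ... | no _ = refl
  Fd-vertex (inj₂ i , k) = refl

  K4-corner-0 : ∀ i → (zero , i) ≡ K4σ (suc i , K4-port i zero)
  K4-corner-0 zero = refl
  K4-corner-0 (suc zero) = refl
  K4-corner-0 (suc (suc zero)) = refl

  K4-corner-1 : ∀ i
    → (suc (next i) , K4-port (next i) (suc (suc zero))) ≡ K4σ (suc i , K4-port i (suc zero))
  K4-corner-1 zero = refl
  K4-corner-1 (suc zero) = refl
  K4-corner-1 (suc (suc zero)) = refl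

  K4-corner-2 : ∀ i
    → (suc (prev i) , K4-port (prev i) (suc zero)) ≡ K4σ (suc i , K4-port i (suc (suc zero)))
  K4-corner-2 zero = refl
  K4-corner-2 (suc zero) = refl
  K4-corner-2 (suc (suc zero)) = refl

  K4-port-0 : ∀ i → K4-port i zero ≡ zero
  K4-port-0 zero = refl
  K4-port-0 (suc zero) = refl
  K4-port-0 (suc (suc zero)) = refl

  Fd-σ : ∀ d → Fd (σ' d) ≡ K4σ (Fd d)
  Fd-σ (u , k) with view u
  Fd-σ (.(t i) , zero) | corner i = begin
    Fd (σ' (t i , zero))                            ≡⟨ cong Fd (σ'-corner i zero) ⟩
    Fd (inj₁ (neighbour i) , proj₂ (σ Y (y , i)))
      ≡⟨ cong (λ u → Fd (inj₁ u , proj₂ (σ Y (y , i)))) (neighbour≡z i) ⟩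
    Fd (inj₁ z , proj₂ (σ Y (y , i)))               ≡⟨ Fd-z _ ⟩
    (zero , proj₂ (σ Y (z , proj₂ (σ Y (y , i)))))  ≡⟨ cong (zero ,_) (cong proj₂ (σ-zy i)) ⟩
    (zero , i)                                      ≡⟨ K4-corner-0 i ⟩
    K4σ (suc i , K4-port i zero)                    ≡⟨ cong K4σ (sym (Fd-t i zero)) ⟩
    K4σ (Fd (t i , zero))                           ∎
    where open ≡-Reasoning
  Fd-σ (.(t i) , suc zero) | corner i = trans (cong Fd (σ'-corner i (suc zero)))
    (trans (Fd-t (next i) _) (trans (K4-corner-1 i) (cong K4σ (sym (Fd-t i _)))))
  Fd-σ (.(t i) , suc (suc zero)) | corner i = trans (cong Fd (σ'-corner i (suc (suc zero))))
    (trans (Fd-t (prev i) _) (trans (K4-corner-2 i) (cong K4σ (sym (Fd-t i _)))))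
  Fd-σ (.(inj₁ x) , k) | old x x≢y with y⊎z x
  ... | inj₁ x≡y = ⊥-elim (x≢y x≡y)
  ... | inj₂ refl = begin
    Fd (σ' (inj₁ z , k))                       ≡⟨ cong Fd (σ'-old z k x≢y) ⟩
    Fd (ext (σ Y (z , k)))                     ≡⟨ cong (λ u → Fd (ext (u , m))) (z-neighbour≡y k) ⟩
    Fd (ext (y , m))                           ≡⟨ cong Fd (ext-at-v m) ⟩
    Fd (t m , zero)                            ≡⟨ Fd-t m zero ⟩
    (suc m , K4-port m zero)                   ≡⟨ cong (suc m ,_) (K4-port-0 m) ⟩
    K4σ (zero , m)                             ≡⟨ cong K4σ (sym (Fd-z k)) ⟩
    K4σ (Fd (inj₁ z , k))                      ∎
    where
    open ≡-Reasoning
    m : Fin 3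
    m = proj₂ (σ Y (z , k))

  iso : (Y ^ y) ≅ K4
  iso = mk≅ Fv Gv FG GF Fd Gd FGd GFd Fd-vertex Fd-σ

contract-K4-small : ∀ {B} (S : Triangle B) → B ≅ K4 → Small (B / S)
contract-K4-small {B} S ψ = c , Πv y₀ , c⊎y₀
  where
  open Contraction B S
  open Iso ψ
  y₀ : V B
  y₀ = proj₁ (σ B (vertex zero , exit zero))
  y₀-outside : Outside y₀
  y₀-outside i e = exit-leaves zero i (sym e)
  c⊎y₀ : ∀ u → u ≡ c ⊎ u ≡ Πv y₀
  c⊎y₀ u with vertexView u
  ... | contracted = inj₁ refl
  ... | kept-vertex x pf x-outside with _≟_ B x y₀
  ...   | yes x≡y₀ = inj₂ (trans (Vertex-≡ x≡y₀) (sym (Πv-outside y₀-outside)))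
  ...   | no x≢y₀ = ⊥-elim (Fin.<⇒notInjective (n<1+n 4) (five-injective ∘ f-injective))
    where
    five : Fin 5 → V B
    five zero = x
    five (suc zero) = y₀
    five (suc (suc k)) = vertex k
    five-injective : Injective _≡_ _≡_ five
    five-injective {zero} {zero} _ = refl
    five-injective {zero} {suc zero} e = ⊥-elim (x≢y₀ e)
    five-injective {zero} {suc (suc k)} e = ⊥-elim (x-outside k (sym e))
    five-injective {suc zero} {zero} e = ⊥-elim (x≢y₀ (sym e))
    five-injective {suc zero} {suc zero} _ = refl
    five-injective {suc zero} {suc (suc k)} e = ⊥-elim (y₀-outside k (sym e))
    five-injective {suc (suc k)} {zero} e = ⊥-elim (x-outside k e)
    five-injective {suc (suc k)} {suc zero} e = ⊥-elim (y₀-outside k e)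
    five-injective {suc (suc k)} {suc (suc k′)} e = cong (suc ∘ suc) (vertex-injective e)

expand-Klee-or-Small : ∀ {Z} → IsCubic Z → Klee Z ⊎ Small Z → ∀ z → Klee (Z ^ z)
expand-Klee-or-Small _ (inj₁ klee) z = step _ z klee ≅-refl
expand-Klee-or-Small cubic (inj₂ small) z = k4 (ExpandSmall.iso cubic small z)

module ContractInExpansion {H B : Graph} {w : V H} (cubic : IsCubic H) (simple : Simple H)
  (ψ : B ≅ (H ^ w)) (S : Triangle B) where
  open Iso ψ
  open TrianglesOfExpansion cubic simple w (Triangle-map ψ S)

  cubic-B : IsCubic B
  cubic-B = IsCubic-resp-≅ (IsCubic-^ cubic w) (≅-sym ψ)

  contract-new : ∀ corners → B / S ≅ H
  contract-new corners = ≅-trans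
    (ContractionMap.iso cubic-B ψ S (expansion-triangle cubic w) π π⁻¹ π-π⁻¹
      (λ i → trans (δ-form _) (cong₂ _,_ (vertex≡t i) (exit≡0 i))))
    (contract-expansion cubic w)
    where open New corners

  contract-disjoint : ∀ ¬corners → let open Disjoint ¬corners in
    B / S ≅ ((H / S↓) ^ ExpandContract.w* cubic w S↓ avoid)
  contract-disjoint ¬corners = ≅-trans
    (ContractionMap.iso cubic-B ψ S S↑ (λ i → i) (λ i → i) (λ _ → refl)
      (λ i → trans (δ-form _) (cong (_, _) (vertex≡inj₁ i))))
    iso
    where
    open Disjoint ¬corners
    open ExpandContract cubic w S↓ avoid

  contract : (∀ T → Klee (H / T) ⊎ Small (H / T)) → Klee H → Klee (B / S)
  contract IH klee with new-or-disjoint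
  ... | inj₁ corners = Klee-resp-≅ klee (≅-sym (contract-new corners))
  ... | inj₂ ¬corners = Klee-resp-≅
    (expand-Klee-or-Small (IsCubic-/ cubic S↓) (IH S↓) _) (≅-sym (contract-disjoint ¬corners))
    where open Disjoint ¬corners

contract-Klee : ∀ {X B} → Klee X → X ≅ B → (S : Triangle B) → Klee (B / S) ⊎ Small (B / S)
contract-Klee (k4 φ) ψ S = inj₂ (contract-K4-small S (≅-trans (≅-sym ψ) φ))
contract-Klee (step H w klee φ) ψ S = inj₁ (ContractInExpansion.contract
  (Klee-cubic klee) (Klee-simple klee) (≅-trans (≅-sym ψ) φ) S (contract-Klee klee ≅-refl) klee)

lemma5 : (G : Graph) (n : ℕ) → HasOrder G n → IsCubic G → 4 ≤ n
    → (v : V G) → Klee (G ^ v) → Klee G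
lemma5 G n order cubic 4≤n v klee with contract-Klee klee ≅-refl (expansion-triangle cubic v)
... | inj₁ klee′ = Klee-resp-≅ klee′ (contract-expansion cubic v)
... | inj₂ small = ⊥-elim (¬Small {G} order (≤-trans (n≤1+n 3) 4≤n)
                            (Small-resp-≅ small (contract-expansion cubic v)))
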